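{- Let $N$ be a natural number and let $q,c,d,e,z$ be complex numbers with $c,d,e\ne0$ and such that no denominator below vanishes. Then \[ \sum_{n=1}^N \begin{bmatrix} N\\ n \end{bmatrix} \frac{(q)_n (c/d)_n (q/e)_{n-1} (-zd)^n q^{n(n+1)/2} e^{n-1} }{(zq)_n(cq)_n(q)_{n-1}} = \frac{z(c-d)}{c(cq)_N} \sum_{n=1}^N \begin{bmatrix} N\\ n \end{bmatrix} \frac{(q)_n(ceq)_{N-n} (zdq/c)_{n-1}(q/e)_{n-1}(cq)^n e^{n-1}}{(zq)_{n}(q)_{n-1}}. \]
   Context: For complex $x$: $(x)_0=1$, $(x)_n=(1-x)(1-xq)\cdots(1-xq^{n-1})$ for $n\ge1$. The $q$-binomial coefficient is $\begin{bmatrix} N\\ n \end{bmatrix}=\frac{(q)_N}{(q)_n(q)_{N-n}}$ for $0\le n\le N$ and $0$ otherwise. -}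

module Defs where

open import Level using (Level; _⊔_) renaming (suc to lsuc)
open import Algebra.Bundles using (CommutativeRing)
open import Data.Nat using (ℕ; zero; suc; _≤ᵇ_; _∸_)
import Data.Nat as ℕ
open import Data.Nat.DivMod using (_/_)
open import Data.Bool using (if_then_else_)
open import Relation.Nullary using (¬_)

-- A field: a commutative ring with 0 ≠ 1 and a (total) inverse operation
-- that is a multiplicative inverse on every nonzero element
-- (the value of 0⁻¹ is irrelevant; ℂ with 0⁻¹ = 0 is an instance).
-- n(n+1)/2
tri : ℕ → ℕ
tri n = (n ℕ.* (n ℕ.+ 1)) / 2

record Field (a ℓ : Level) : Set (lsuc (a ⊔ ℓ)) where
  field
    commutativeRing : CommutativeRing a ℓ
  open CommutativeRing commutativeRing public
  field
    _⁻¹ : Carrier → Carrier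
    ⁻¹-inverse : ∀ x → ¬ x ≈ 0# → x * (x ⁻¹) ≈ 1#
    0≉1 : ¬ 0# ≈ 1#

module FieldOps {a ℓ : Level} (F : Field a ℓ) where
  open Field F

  _÷_ : Carrier → Carrier → Carrier
  x ÷ y = x * (y ⁻¹)

  pow : Carrier → ℕ → Carrier
  pow x zero = 1#
  pow x (suc n) = pow x n * x

  poch : (q x : Carrier) → ℕ → Carrier
  poch q x zero = 1#
  poch q x (suc n) = poch q x n * (1# - x * pow q n)

  qbinom : (q : Carrier) → ℕ → ℕ → Carrier
  qbinom q N n =
    if n ≤ᵇ N
    then poch q q N ÷ (poch q q n * poch q q (N ∸ n))
    else 0#

  sum1 : ℕ → (ℕ → Carrier) → Carrier
  sum1 zero f = 0#
  sum1 (suc N) f = sum1 N f + f (suc N)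

-- Write N = M + 1 and n = m + 1. Since (xq)_N = (xq)_{m+1} (xq^{m+2})_{M-m} and
-- [N, m+1] (q)_{m+1} = (1 - q^N) [M, m] (q)_m, both sides become sums over m ≤ M of [M, m] times a
-- polynomial, divided by a common denominator, and the theorem reduces to a polynomial identity.
-- On its right-hand side, expand ∏_{l<j} (c - zdq^{l+1}) as a q-binomial sum (induction on j through
-- the q-Pascal rule), interchange the two summations, and evaluate the inner sum by the
-- q-Chu–Vandermonde identity  Σ_i [n, i] (h)_{n-i} h^i (u/h)_i = (u)_n;  what is left is the left-hand side.

module Submission where

open import Defs
open import Data.Nat using (ℕ; _≤_; _∸_)
open import Data.Product using (_×_; proj₁; proj₂)
open import Relation.Nullary using (¬_)

open import Algebra.Bundles using (CommutativeRing)
open import Algebra.Solver.Ring.AlmostCommutativeRing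
  using (_-Raw-AlmostCommutative⟶_; fromCommutativeRing)
open import Data.Nat as ℕ using (zero; suc; _<_; z≤n; s≤s)
import Data.Nat.Properties as ℕ
open import Data.Integer as ℤ using (ℤ; +_; -[1+_]; _⊖_; sign; ∣_∣; _◃_)
import Data.Integer.Properties as ℤ
open import Data.Sign as Sign using (Sign)
open import Data.Maybe using (Maybe; just; nothing)
open import Relation.Binary.PropositionalEquality as ≡ using (_≡_)
open import Relation.Nullary using (yes; no)
open import Data.Nat.DivMod using (_/_; /-congˡ; +-distrib-/-∣ˡ; m*n/n≡m)
open import Data.Nat.Divisibility using (divides-refl)
open import Data.Sum using (inj₁; inj₂)
open import Data.Bool using (T; true; false)
open import Data.Unit using (tt)
open import Data.Empty using (⊥-elim)

-- The library instantiates Algebra.Solver.Ring only with natural coefficients (no subtraction) or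
-- over rings with decidable equality; here the coefficients are integers, interpreted as n · 1#.
module IntegerCoefficientSolver {c ℓ} (R : CommutativeRing c ℓ) where
  open CommutativeRing R
  open import Algebra.Properties.Ring ring
    using (-‿distribˡ-*; -‿distribʳ-*; -‿involutive; -‿+-comm; -0#≈0#)
  open import Algebra.Properties.Semiring.Mult.TCOptimised semiring
    using (×-homo-+; ×1-homo-*; 1+×) renaming (_×_ to _·_)
  open import Relation.Binary.Reasoning.Setoid setoid

  ⟦_⟧ℤ : ℤ → Carrier
  ⟦ + n ⟧ℤ = n · 1#
  ⟦ -[1+ n ] ⟧ℤ = - (suc n · 1#)

  private
    cancel-1+ : ∀ x y → (1# + x) - (1# + y) ≈ x - y
    cancel-1+ x y = begin
      (1# + x) + - (1# + y)    ≈⟨ +-congˡ (-‿+-comm 1# y) ⟨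
      (1# + x) + (- 1# + - y)  ≈⟨ +-assoc 1# x _ ⟩
      1# + (x + (- 1# + - y))  ≈⟨ +-congˡ (+-assoc x (- 1#) (- y)) ⟨
      1# + ((x + - 1#) + - y)  ≈⟨ +-congˡ (+-congʳ (+-comm x (- 1#))) ⟩
      1# + ((- 1# + x) + - y)  ≈⟨ +-congˡ (+-assoc (- 1#) x (- y)) ⟩
      1# + (- 1# + (x - y))    ≈⟨ +-assoc 1# (- 1#) _ ⟨
      (1# + - 1#) + (x - y)    ≈⟨ +-congʳ (-‿inverseʳ 1#) ⟩
      0# + (x - y)             ≈⟨ +-identityˡ _ ⟩
      x - y                    ∎

    ⊖-homo : ∀ m n → ⟦ m ⊖ n ⟧ℤ ≈ m · 1# - n · 1#
    ⊖-homo zero zero = sym (-‿inverseʳ 0#)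
    ⊖-homo (suc m) zero = sym (trans (+-congˡ -0#≈0#) (+-identityʳ _))
    ⊖-homo zero (suc n) = sym (+-identityˡ _)
    ⊖-homo (suc m) (suc n) = begin
      ⟦ suc m ⊖ suc n ⟧ℤ            ≡⟨ ≡.cong ⟦_⟧ℤ (ℤ.[1+m]⊖[1+n]≡m⊖n m n) ⟩
      ⟦ m ⊖ n ⟧ℤ                    ≈⟨ ⊖-homo m n ⟩
      m · 1# - n · 1#               ≈⟨ cancel-1+ _ _ ⟨
      (1# + m · 1#) - (1# + n · 1#) ≈⟨ +-cong (1+× m 1#) (-‿cong (1+× n 1#)) ⟨
      suc m · 1# - suc n · 1#       ∎

    +-homo : ∀ i j → ⟦ i ℤ.+ j ⟧ℤ ≈ ⟦ i ⟧ℤ + ⟦ j ⟧ℤ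
    +-homo -[1+ m ] -[1+ n ] = begin
      - (suc (suc (m ℕ.+ n)) · 1#)      ≡⟨ ≡.cong (λ k → - (suc k · 1#)) (ℕ.+-suc m n) ⟨
      - ((suc m ℕ.+ suc n) · 1#)        ≈⟨ -‿cong (×-homo-+ 1# (suc m) (suc n)) ⟩
      - (suc m · 1# + suc n · 1#)       ≈⟨ -‿+-comm _ _ ⟨
      - (suc m · 1#) + - (suc n · 1#)   ∎
    +-homo -[1+ m ] (+ n) = trans (⊖-homo n (suc m)) (+-comm _ _)
    +-homo (+ m) -[1+ n ] = ⊖-homo m (suc n)
    +-homo (+ m) (+ n) = ×-homo-+ 1# m n

    -‿homo : ∀ i → ⟦ ℤ.- i ⟧ℤ ≈ - ⟦ i ⟧ℤ
    -‿homo -[1+ n ] = sym (-‿involutive _)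
    -‿homo (+ zero) = sym -0#≈0#
    -‿homo (+ suc n) = refl

    signed : Sign → Carrier → Carrier
    signed Sign.+ x = x
    signed Sign.- x = - x

    signed-cong : ∀ s {x y} → x ≈ y → signed s x ≈ signed s y
    signed-cong Sign.+ p = p
    signed-cong Sign.- p = -‿cong p

    ◃-homo : ∀ s n → ⟦ s ◃ n ⟧ℤ ≈ signed s (n · 1#)
    ◃-homo Sign.+ zero = refl
    ◃-homo Sign.- zero = sym -0#≈0#
    ◃-homo Sign.+ (suc n) = refl
    ◃-homo Sign.- (suc n) = refl

    signed-* : ∀ s t x y → signed (s Sign.* t) (x * y) ≈ signed s x * signed t y
    signed-* Sign.+ Sign.+ x y = refl
    signed-* Sign.+ Sign.- x y = -‿distribʳ-* x y
    signed-* Sign.- Sign.+ x y = -‿distribˡ-* x y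
    signed-* Sign.- Sign.- x y = begin
      x * y          ≈⟨ -‿involutive _ ⟨
      - - (x * y)    ≈⟨ -‿cong (-‿distribˡ-* x y) ⟩
      - (- x * y)    ≈⟨ -‿distribʳ-* (- x) y ⟩
      - x * - y      ∎

    sign-abs : ∀ i → ⟦ i ⟧ℤ ≈ signed (sign i) (∣ i ∣ · 1#)
    sign-abs i = trans (reflexive (≡.cong ⟦_⟧ℤ (≡.sym (ℤ.◃-inverse i)))) (◃-homo (sign i) ∣ i ∣)

    *-homo : ∀ i j → ⟦ i ℤ.* j ⟧ℤ ≈ ⟦ i ⟧ℤ * ⟦ j ⟧ℤ
    *-homo i j = begin
      ⟦ (sign i Sign.* sign j) ◃ (∣ i ∣ ℕ.* ∣ j ∣) ⟧ℤ
        ≈⟨ ◃-homo (sign i Sign.* sign j) (∣ i ∣ ℕ.* ∣ j ∣) ⟩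
      signed (sign i Sign.* sign j) ((∣ i ∣ ℕ.* ∣ j ∣) · 1#)
        ≈⟨ signed-cong (sign i Sign.* sign j) (×1-homo-* ∣ i ∣ ∣ j ∣) ⟩
      signed (sign i Sign.* sign j) (∣ i ∣ · 1# * ∣ j ∣ · 1#)
        ≈⟨ signed-* (sign i) (sign j) _ _ ⟩
      signed (sign i) (∣ i ∣ · 1#) * signed (sign j) (∣ j ∣ · 1#)
        ≈⟨ *-cong (sign-abs i) (sign-abs j) ⟨
      ⟦ i ⟧ℤ * ⟦ j ⟧ℤ ∎

  ℤ-homomorphism : ℤ.+-*-rawRing -Raw-AlmostCommutative⟶ fromCommutativeRing R
  ℤ-homomorphism = record
    { ⟦_⟧ = ⟦_⟧ℤ ; +-homo = +-homo ; *-homo = *-homo ; -‿homo = -‿homo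
    ; 0-homo = refl ; 1-homo = refl }

  ℤ-equal? : ∀ i j → Maybe (⟦ i ⟧ℤ ≈ ⟦ j ⟧ℤ)
  ℤ-equal? i j with i ℤ.≟ j
  ... | yes ≡.refl = just refl
  ... | no _ = nothing

  open import Algebra.Solver.Ring ℤ.+-*-rawRing (fromCommutativeRing R) ℤ-homomorphism ℤ-equal? public

module FiniteSums {c ℓ} (R : CommutativeRing c ℓ) where
  open CommutativeRing R
  open import Algebra.Properties.CommutativeSemigroup +-commutativeSemigroup using (interchange)
  open import Relation.Binary.Reasoning.Setoid setoid

  sum≤ : ℕ → (ℕ → Carrier) → Carrier
  sum≤ zero f = f 0
  sum≤ (suc n) f = sum≤ n f + f (suc n)

  syntax sum≤ n (λ i → e) = ∑[ i ≤ n ] e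

  ∑-cong : ∀ n {f g : ℕ → Carrier} → (∀ i → i ≤ n → f i ≈ g i) → sum≤ n f ≈ sum≤ n g
  ∑-cong zero f≈g = f≈g 0 z≤n
  ∑-cong (suc n) f≈g = +-cong (∑-cong n (λ i i≤n → f≈g i (ℕ.m≤n⇒m≤1+n i≤n))) (f≈g (suc n) ℕ.≤-refl)

  ∑-suc : ∀ n (f : ℕ → Carrier) → sum≤ (suc n) f ≈ f 0 + ∑[ i ≤ n ] f (suc i)
  ∑-suc zero f = refl
  ∑-suc (suc n) f = trans (+-congʳ (∑-suc n f)) (+-assoc _ _ _)

  ∑-+ : ∀ n (f g : ℕ → Carrier) → ∑[ i ≤ n ] (f i + g i) ≈ sum≤ n f + sum≤ n g
  ∑-+ zero f g = refl
  ∑-+ (suc n) f g = trans (+-congʳ (∑-+ n f g)) (interchange _ _ _ _)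

  ∑-distribˡ : ∀ n x (f : ℕ → Carrier) → x * sum≤ n f ≈ ∑[ i ≤ n ] (x * f i)
  ∑-distribˡ zero x f = refl
  ∑-distribˡ (suc n) x f = trans (distribˡ _ _ _) (+-congʳ (∑-distribˡ n x f))

  ∑-distribʳ : ∀ n x (f : ℕ → Carrier) → sum≤ n f * x ≈ ∑[ i ≤ n ] (f i * x)
  ∑-distribʳ zero x f = refl
  ∑-distribʳ (suc n) x f = trans (distribʳ _ _ _) (+-congʳ (∑-distribʳ n x f))

  ∑-comm : ∀ n m (f : ℕ → ℕ → Carrier) → ∑[ i ≤ n ] sum≤ m (f i) ≈ ∑[ j ≤ m ] ∑[ i ≤ n ] f i j
  ∑-comm zero m f = refl
  ∑-comm (suc n) m f = trans (+-congʳ (∑-comm n m f)) (sym (∑-+ m _ _))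

  ∑-dropInitial : ∀ k n (f : ℕ → Carrier) → (∀ j → j < k → f j ≈ 0#) →
                  sum≤ (k ℕ.+ n) f ≈ ∑[ i ≤ n ] f (k ℕ.+ i)
  ∑-dropInitial zero n f _ = refl
  ∑-dropInitial (suc k) n f f≈0 = begin
    sum≤ (suc (k ℕ.+ n)) f                    ≈⟨ ∑-suc (k ℕ.+ n) f ⟩
    f 0 + sum≤ (k ℕ.+ n) (λ i → f (suc i))
      ≈⟨ +-cong (f≈0 0 (s≤s z≤n)) (∑-dropInitial k n _ (λ j j<k → f≈0 (suc j) (s≤s j<k))) ⟩
    0# + ∑[ i ≤ n ] f (suc k ℕ.+ i)           ≈⟨ +-identityˡ _ ⟩
    ∑[ i ≤ n ] f (suc k ℕ.+ i)                ∎

  ∑-extend : ∀ {n} m (f : ℕ → Carrier) → n ≤ m → (∀ i → n < i → f i ≈ 0#) → sum≤ n f ≈ sum≤ m f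
  ∑-extend zero f z≤n _ = refl
  ∑-extend {n} (suc m) f n≤1+m f≈0 with ℕ.m≤n⇒m<n∨m≡n n≤1+m
  ... | inj₂ ≡.refl = refl
  ... | inj₁ (s≤s n≤m) = begin
    sum≤ n f               ≈⟨ ∑-extend m f n≤m f≈0 ⟩
    sum≤ m f               ≈⟨ +-identityʳ _ ⟨
    sum≤ m f + 0#          ≈⟨ +-congˡ (f≈0 (suc m) (s≤s n≤m)) ⟨
    sum≤ (suc m) f         ∎

tri-suc : ∀ n → tri (suc n) ≡ suc n ℕ.+ tri n
tri-suc n = begin
  suc n ℕ.* (suc n ℕ.+ 1) / 2
    ≡⟨ /-congˡ {o = 2} (solve 1 (λ n → (con 1 :+ n) :* (con 1 :+ n :+ con 1) := (con 1 :+ n) :* con 2 :+ n :* (n :+ con 1)) ≡.refl n) ⟩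
  (suc n ℕ.* 2 ℕ.+ n ℕ.* (n ℕ.+ 1)) / 2 ≡⟨ +-distrib-/-∣ˡ {suc n ℕ.* 2} (n ℕ.* (n ℕ.+ 1)) (divides-refl (suc n)) ⟩
  suc n ℕ.* 2 / 2 ℕ.+ tri n             ≡⟨ ≡.cong (ℕ._+ tri n) (m*n/n≡m (suc n) 2) ⟩
  suc n ℕ.+ tri n                       ∎
  where
  open ≡.≡-Reasoning
  open import Data.Nat.Solver using (module +-*-Solver)
  open +-*-Solver

∸-telescope : ∀ {k j m} → k ≤ j → j ≤ m → (j ∸ k) ℕ.+ (m ∸ j) ≡ m ∸ k
∸-telescope {k} {j} {m} k≤j j≤m = begin
  (j ∸ k) ℕ.+ (m ∸ j)       ≡⟨ ℕ.+-comm (j ∸ k) (m ∸ j) ⟩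
  (m ∸ j) ℕ.+ (j ∸ k)       ≡⟨ ℕ.+-∸-assoc (m ∸ j) k≤j ⟨
  ((m ∸ j) ℕ.+ j) ∸ k       ≡⟨ ≡.cong (_∸ k) (ℕ.m∸n+n≡m j≤m) ⟩
  m ∸ k                     ∎
  where open ≡.≡-Reasoning

module QSeries {a ℓ} (F : Field a ℓ) where
  open Field F
  open FieldOps F
  open IntegerCoefficientSolver commutativeRing
  open FiniteSums commutativeRing
  open import Algebra.Properties.Ring ring using (-‿distribˡ-*)
  open import Algebra.Properties.CommutativeSemigroup +-commutativeSemigroup
    using () renaming (x∙yz≈y∙xz to x+yz≈y+xz)
  open import Algebra.Properties.CommutativeSemigroup *-commutativeSemigroup
    using () renaming (x∙yz≈y∙xz to x*yz≈y*xz)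
  open import Relation.Binary.Reasoning.Setoid setoid

  *-≉0 : ∀ {x y} → ¬ x ≈ 0# → ¬ y ≈ 0# → ¬ x * y ≈ 0#
  *-≉0 {x} {y} x≉0 y≉0 xy≈0 = y≉0 (begin
    y                  ≈⟨ *-identityˡ y ⟨
    1# * y             ≈⟨ *-congʳ (⁻¹-inverse x x≉0) ⟨
    x * x ⁻¹ * y       ≈⟨ solve 3 (λ x x⁻¹ y → x :* x⁻¹ :* y := x⁻¹ :* (x :* y)) refl x (x ⁻¹) y ⟩
    x ⁻¹ * (x * y)     ≈⟨ *-congˡ xy≈0 ⟩
    x ⁻¹ * 0#          ≈⟨ zeroʳ _ ⟩
    0#                 ∎)

  *-÷-cancel : ∀ {x y} → ¬ y ≈ 0# → (x * y) ÷ y ≈ x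
  *-÷-cancel {x} {y} y≉0 = begin
    x * y * y ⁻¹       ≈⟨ *-assoc x y (y ⁻¹) ⟩
    x * (y * y ⁻¹)     ≈⟨ *-congˡ (⁻¹-inverse y y≉0) ⟩
    x * 1#             ≈⟨ *-identityʳ x ⟩
    x                  ∎

  ÷-*-cancel : ∀ {x y} → ¬ y ≈ 0# → x ÷ y * y ≈ x
  ÷-*-cancel {x} {y} y≉0 = trans (solve 3 (λ x y y⁻¹ → x :* y⁻¹ :* y := x :* y :* y⁻¹) refl x y (y ⁻¹)) (*-÷-cancel y≉0)

  *-cancelʳ : ∀ {x y w} → ¬ w ≈ 0# → x * w ≈ y * w → x ≈ y
  *-cancelʳ {x} {y} {w} w≉0 xw≈yw = begin
    x                  ≈⟨ *-÷-cancel w≉0 ⟨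
    (x * w) ÷ w        ≈⟨ *-congʳ xw≈yw ⟩
    (y * w) ÷ w        ≈⟨ *-÷-cancel w≉0 ⟩
    y                  ∎

  ÷-intro : ∀ {x y z} → ¬ y ≈ 0# → x * y ≈ z → x ≈ z ÷ y
  ÷-intro y≉0 xy≈z = *-cancelʳ y≉0 (trans xy≈z (sym (÷-*-cancel y≉0)))

  ÷-cross : ∀ {x y u v} → ¬ y ≈ 0# → ¬ v ≈ 0# → x * v ≈ u * y → x ÷ y ≈ u ÷ v
  ÷-cross {x} {y} {u} {v} y≉0 v≉0 xv≈uy = ÷-intro v≉0 (*-cancelʳ y≉0 (begin
    x ÷ y * v * y      ≈⟨ solve 3 (λ a v y → a :* v :* y := a :* y :* v) refl (x ÷ y) v y ⟩
    x ÷ y * y * v      ≈⟨ *-congʳ (÷-*-cancel y≉0) ⟩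
    x * v              ≈⟨ xv≈uy ⟩
    u * y              ∎))

  ÷-*-÷ : ∀ {x y u v} → ¬ y ≈ 0# → ¬ v ≈ 0# → (x ÷ y) * (u ÷ v) ≈ (x * u) ÷ (y * v)
  ÷-*-÷ {x} {y} {u} {v} y≉0 v≉0 = ÷-intro (*-≉0 y≉0 v≉0) (begin
    x ÷ y * (u ÷ v) * (y * v)    ≈⟨ solve 4 (λ a b y v → a :* b :* (y :* v) := a :* y :* (b :* v)) refl (x ÷ y) (u ÷ v) y v ⟩
    x ÷ y * y * (u ÷ v * v)      ≈⟨ *-cong (÷-*-cancel y≉0) (÷-*-cancel v≉0) ⟩
    x * u                        ∎)

  ÷-rescale : ∀ {a b s t x y w} → ¬ x ≈ 0# → ¬ y ≈ 0# → ¬ w ≈ 0# → a * w ≈ b * s →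
              (a * t) ÷ (x * y) ≈ (b ÷ (w * y)) * ((s * t) ÷ x)
  ÷-rescale {a} {b} {s} {t} {x} {y} {w} x≉0 y≉0 w≉0 aw≈bs =
    sym (trans (÷-*-÷ (*-≉0 w≉0 y≉0) x≉0) (÷-cross (*-≉0 (*-≉0 w≉0 y≉0) x≉0) (*-≉0 x≉0 y≉0) (begin
      b * (s * t) * (x * y)   ≈⟨ solve 5 (λ b s t x y → b :* (s :* t) :* (x :* y) := b :* s :* (t :* y :* x)) refl b s t x y ⟩
      b * s * (t * y * x)     ≈⟨ *-congʳ aw≈bs ⟨
      a * w * (t * y * x)     ≈⟨ solve 5 (λ a w t y x → a :* w :* (t :* y :* x) := a :* t :* (w :* y :* x)) refl a w t y x ⟩
      a * t * (w * y * x)     ∎)))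

  sum1-suc : ∀ n (f : ℕ → Carrier) → sum1 (suc n) f ≈ ∑[ i ≤ n ] f (suc i)
  sum1-suc zero f = +-identityˡ _
  sum1-suc (suc n) f = +-congʳ (sum1-suc n f)

  sum1-suc-÷ : ∀ n (f g : ℕ → Carrier) x y → (∀ i → i ≤ n → f (suc i) ≈ (x * g i) ÷ y) →
               sum1 (suc n) f ≈ (x * sum≤ n g) ÷ y
  sum1-suc-÷ n f g x y f≈ = begin
    sum1 (suc n) f                 ≈⟨ sum1-suc n f ⟩
    ∑[ i ≤ n ] f (suc i)           ≈⟨ ∑-cong n f≈ ⟩
    ∑[ i ≤ n ] ((x * g i) ÷ y)     ≈⟨ ∑-distribʳ n (y ⁻¹) _ ⟨
    (∑[ i ≤ n ] (x * g i)) ÷ y     ≈⟨ *-congʳ (∑-distribˡ n x g) ⟨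
    (x * sum≤ n g) ÷ y             ∎

  pow-cong : ∀ {x y} n → x ≈ y → pow x n ≈ pow y n
  pow-cong zero x≈y = refl
  pow-cong (suc n) x≈y = *-cong (pow-cong n x≈y) x≈y

  pow-+ : ∀ x m n → pow x (m ℕ.+ n) ≈ pow x m * pow x n
  pow-+ x zero n = sym (*-identityˡ _)
  pow-+ x (suc m) n = begin
    pow x (m ℕ.+ n) * x          ≈⟨ *-congʳ (pow-+ x m n) ⟩
    pow x m * pow x n * x        ≈⟨ solve 3 (λ a b x → a :* b :* x := a :* x :* b) refl _ _ x ⟩
    pow x m * x * pow x n        ∎

  pow-* : ∀ x y n → pow (x * y) n ≈ pow x n * pow y n
  pow-* x y zero = sym (*-identityˡ _)
  pow-* x y (suc n) = trans (*-congʳ (pow-* x y n))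
    (solve 4 (λ a b x y → a :* b :* (x :* y) := a :* x :* (b :* y)) refl _ _ x y)

  pow-+-∸ : ∀ x m {k n} → k ≤ n → pow x (m ℕ.+ k) * pow x (n ∸ k) ≈ pow x (m ℕ.+ n)
  pow-+-∸ x m {k} {n} k≤n = begin
    pow x (m ℕ.+ k) * pow x (n ∸ k)    ≈⟨ pow-+ x (m ℕ.+ k) (n ∸ k) ⟨
    pow x (m ℕ.+ k ℕ.+ (n ∸ k))        ≡⟨ ≡.cong (pow x) (ℕ.+-assoc m k (n ∸ k)) ⟩
    pow x (m ℕ.+ (k ℕ.+ (n ∸ k)))      ≡⟨ ≡.cong (λ i → pow x (m ℕ.+ i)) (ℕ.m+[n∸m]≡n k≤n) ⟩
    pow x (m ℕ.+ n)                    ∎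

  pow-tri-suc : ∀ q n → pow q (tri (suc n)) ≈ pow q (suc n) * pow q (tri n)
  pow-tri-suc q n = trans (reflexive (≡.cong (pow q) (tri-suc n))) (pow-+ q (suc n) (tri n))

  module _ (q : Carrier) where

    -- yⁿ (x/y)ₙ without the division
    hpoch : Carrier → Carrier → ℕ → Carrier
    hpoch y x zero = 1#
    hpoch y x (suc n) = hpoch y x n * (y - x * pow q n)

    poch≈hpoch : ∀ x n → poch q x n ≈ hpoch 1# x n
    poch≈hpoch x zero = refl
    poch≈hpoch x (suc n) = *-congʳ (poch≈hpoch x n)

    hpoch-cong : ∀ {y y′ x x′} n → y ≈ y′ → x ≈ x′ → hpoch y x n ≈ hpoch y′ x′ n
    hpoch-cong zero y≈y′ x≈x′ = refl
    hpoch-cong (suc n) y≈y′ x≈x′ = *-cong (hpoch-cong n y≈y′ x≈x′) (+-cong y≈y′ (-‿cong (*-congʳ x≈x′)))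

    poch-cong : ∀ {x x′} n → x ≈ x′ → poch q x n ≈ poch q x′ n
    poch-cong {x} {x′} n x≈x′ = trans (poch≈hpoch x n) (trans (hpoch-cong n refl x≈x′) (sym (poch≈hpoch x′ n)))

    hpoch-suc : ∀ y x n → hpoch y x (suc n) ≈ (y - x) * hpoch y (x * q) n
    hpoch-suc y x zero = solve 2 (λ y x → con (+ 1) :* (y :- x :* con (+ 1)) := (y :- x) :* con (+ 1)) refl y x
    hpoch-suc y x (suc n) = begin
      hpoch y x (suc n) * (y - x * (pow q n * q))              ≈⟨ *-congʳ (hpoch-suc y x n) ⟩
      (y - x) * hpoch y (x * q) n * (y - x * (pow q n * q))
        ≈⟨ solve 5 (λ y x h qⁿ q → (y :- x) :* h :* (y :- x :* (qⁿ :* q)) := (y :- x) :* (h :* (y :- x :* q :* qⁿ))) refl y x _ _ q ⟩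
      (y - x) * (hpoch y (x * q) n * (y - x * q * pow q n))    ∎

    poch-suc : ∀ x n → poch q x (suc n) ≈ (1# - x) * poch q (x * q) n
    poch-suc x n = begin
      poch q x (suc n)              ≈⟨ poch≈hpoch x (suc n) ⟩
      hpoch 1# x (suc n)            ≈⟨ hpoch-suc 1# x n ⟩
      (1# - x) * hpoch 1# (x * q) n ≈⟨ *-congˡ (poch≈hpoch (x * q) n) ⟨
      (1# - x) * poch q (x * q) n   ∎

    hpoch-+ : ∀ y x m n → hpoch y x (m ℕ.+ n) ≈ hpoch y x m * hpoch y (x * pow q m) n
    hpoch-+ y x m zero = begin
      hpoch y x (m ℕ.+ 0)     ≡⟨ ≡.cong (hpoch y x) (ℕ.+-identityʳ m) ⟩
      hpoch y x m             ≈⟨ *-identityʳ _ ⟨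
      hpoch y x m * 1#        ∎
    hpoch-+ y x m (suc n) = begin
      hpoch y x (m ℕ.+ suc n)                                        ≡⟨ ≡.cong (hpoch y x) (ℕ.+-suc m n) ⟩
      hpoch y x (m ℕ.+ n) * (y - x * pow q (m ℕ.+ n))
        ≈⟨ *-cong (hpoch-+ y x m n) (+-congˡ (-‿cong (*-congˡ (pow-+ q m n)))) ⟩
      hpoch y x m * hpoch y (x * pow q m) n * (y - x * (pow q m * pow q n))
        ≈⟨ solve 6 (λ A B y x a b → A :* B :* (y :- x :* (a :* b)) := A :* (B :* (y :- x :* a :* b))) refl _ _ y x _ _ ⟩
      hpoch y x m * (hpoch y (x * pow q m) n * (y - x * pow q m * pow q n)) ∎

    poch-+ : ∀ x m n → poch q x (m ℕ.+ n) ≈ poch q x m * poch q (x * pow q m) n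
    poch-+ x m n = begin
      poch q x (m ℕ.+ n)                          ≈⟨ poch≈hpoch x (m ℕ.+ n) ⟩
      hpoch 1# x (m ℕ.+ n)                        ≈⟨ hpoch-+ 1# x m n ⟩
      hpoch 1# x m * hpoch 1# (x * pow q m) n     ≈⟨ *-cong (poch≈hpoch x m) (poch≈hpoch _ n) ⟨
      poch q x m * poch q (x * pow q m) n         ∎

    poch-split : ∀ x {j n} → j ≤ n → poch q x n ≈ poch q x j * poch q (x * pow q j) (n ∸ j)
    poch-split x {j} j≤n = trans (reflexive (≡.cong (poch q x) (≡.sym (ℕ.m+[n∸m]≡n j≤n)))) (poch-+ x j _)

    hpoch-scale : ∀ s y x n → pow s n * hpoch y x n ≈ hpoch (s * y) (s * x) n
    hpoch-scale s y x zero = *-identityʳ _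
    hpoch-scale s y x (suc n) = begin
      pow s n * s * (hpoch y x n * (y - x * pow q n))
        ≈⟨ solve 6 (λ sⁿ s h y x qⁿ → sⁿ :* s :* (h :* (y :- x :* qⁿ)) := sⁿ :* h :* (s :* y :- s :* x :* qⁿ)) refl _ s _ y x _ ⟩
      pow s n * hpoch y x n * (s * y - s * x * pow q n)   ≈⟨ *-congʳ (hpoch-scale s y x n) ⟩
      hpoch (s * y) (s * x) n * (s * y - s * x * pow q n) ∎

    pow-*-poch-÷ : ∀ y x n → ¬ y ≈ 0# → pow y n * poch q (x ÷ y) n ≈ hpoch y x n
    pow-*-poch-÷ y x n y≉0 = begin
      pow y n * poch q (x ÷ y) n         ≈⟨ *-congˡ (poch≈hpoch (x ÷ y) n) ⟩
      pow y n * hpoch 1# (x ÷ y) n       ≈⟨ hpoch-scale y 1# (x ÷ y) n ⟩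
      hpoch (y * 1#) (y * (x ÷ y)) n     ≈⟨ hpoch-cong n (*-identityʳ y) (trans (*-comm y _) (÷-*-cancel y≉0)) ⟩
      hpoch y x n                        ∎

    QFactorialsNonzero : ℕ → Set ℓ
    QFactorialsNonzero n = ∀ i → i ≤ n → ¬ poch q q i ≈ 0#

    QFactorialsNonzero-≤ : ∀ {m n} → m ≤ n → QFactorialsNonzero n → QFactorialsNonzero m
    QFactorialsNonzero-≤ m≤n nz i i≤m = nz i (ℕ.≤-trans i≤m m≤n)

    QFactorialsNonzero-pred : ∀ {n} → QFactorialsNonzero (suc n) → QFactorialsNonzero n
    QFactorialsNonzero-pred = QFactorialsNonzero-≤ (ℕ.n≤1+n _)

    qbinom-> : ∀ {n k} → n < k → qbinom q n k ≈ 0#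
    qbinom-> {n} {k} n<k with k ℕ.≤ᵇ n in k≤ᵇn
    ... | false = refl
    ... | true = ⊥-elim (ℕ.<⇒≱ n<k (ℕ.≤ᵇ⇒≤ k n (≡.subst T (≡.sym k≤ᵇn) tt)))

    qbinom-*-poch : ∀ {n k} → k ≤ n → QFactorialsNonzero n →
                    qbinom q n k * (poch q q k * poch q q (n ∸ k)) ≈ poch q q n
    qbinom-*-poch {n} {k} k≤n nz with k ℕ.≤ᵇ n in k≤ᵇn
    ... | true = ÷-*-cancel (*-≉0 (nz k k≤n) (nz (n ∸ k) (ℕ.m∸n≤m n k)))
    ... | false = ⊥-elim (≡.subst T k≤ᵇn (ℕ.≤⇒≤ᵇ k≤n))

    qbinom-unique : ∀ {n k x} → k ≤ n → QFactorialsNonzero n →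
                    x * (poch q q k * poch q q (n ∸ k)) ≈ poch q q n → x ≈ qbinom q n k
    qbinom-unique {n} {k} k≤n nz x*w≈pₙ =
      *-cancelʳ (*-≉0 (nz k k≤n) (nz (n ∸ k) (ℕ.m∸n≤m n k))) (trans x*w≈pₙ (sym (qbinom-*-poch k≤n nz)))

    qbinom-n-0 : ∀ {n} → QFactorialsNonzero n → qbinom q n 0 ≈ 1#
    qbinom-n-0 nz = sym (qbinom-unique z≤n nz (trans (*-identityˡ _) (*-identityˡ _)))

    private
      qbinom-*-poch-suc : ∀ {n k} → k ≤ n → QFactorialsNonzero n →
        qbinom q n k * (poch q q (suc k) * poch q q (n ∸ k)) ≈ poch q q n * (1# - pow q (suc k))
      qbinom-*-poch-suc {n} {k} k≤n nz = begin
        qbinom q n k * (poch q q k * (1# - q * pow q k) * poch q q (n ∸ k))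
          ≈⟨ solve 5 (λ g a q qᵏ b → g :* (a :* (con (+ 1) :- q :* qᵏ) :* b) := g :* (a :* b) :* (con (+ 1) :- qᵏ :* q)) refl _ _ q _ _ ⟩
        qbinom q n k * (poch q q k * poch q q (n ∸ k)) * (1# - pow q (suc k))
          ≈⟨ *-congʳ (qbinom-*-poch k≤n nz) ⟩
        poch q q n * (1# - pow q (suc k)) ∎

      qbinom-suc-*-poch-suc : ∀ {n k} → k ≤ n → QFactorialsNonzero n →
        qbinom q n (suc k) * (poch q q (suc k) * poch q q (n ∸ k)) ≈ poch q q n * (1# - pow q (n ∸ k))
      qbinom-suc-*-poch-suc {n} {k} k≤n nz with ℕ.m≤n⇒m<n∨m≡n k≤n
      ... | inj₂ ≡.refl = begin
        qbinom q k (suc k) * _       ≈⟨ *-congʳ (qbinom-> (ℕ.n<1+n k)) ⟩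
        0# * _                       ≈⟨ zeroˡ _ ⟩
        0#                           ≈⟨ zeroʳ _ ⟨
        poch q q k * 0#              ≈⟨ *-congˡ (-‿inverseʳ 1#) ⟨
        poch q q k * (1# - 1#)       ≡⟨ ≡.cong (λ m → poch q q k * (1# - pow q m)) (ℕ.n∸n≡0 k) ⟨
        poch q q k * (1# - pow q (k ∸ k)) ∎
      ... | inj₁ k<n = begin
        qbinom q n (suc k) * (poch q q (suc k) * poch q q (n ∸ k))
          ≡⟨ ≡.cong (λ m → qbinom q n (suc k) * (poch q q (suc k) * poch q q m)) n∸k≡1+t ⟩
        qbinom q n (suc k) * (poch q q (suc k) * (poch q q t * (1# - q * pow q t)))
          ≈⟨ solve 5 (λ g a b q qᵗ → g :* (a :* (b :* (con (+ 1) :- q :* qᵗ))) := g :* (a :* b) :* (con (+ 1) :- qᵗ :* q)) refl _ _ _ q _ ⟩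
        qbinom q n (suc k) * (poch q q (suc k) * poch q q t) * (1# - pow q (suc t))
          ≈⟨ *-congʳ (qbinom-*-poch k<n nz) ⟩
        poch q q n * (1# - pow q (suc t))
          ≡⟨ ≡.cong (λ m → poch q q n * (1# - pow q m)) n∸k≡1+t ⟨
        poch q q n * (1# - pow q (n ∸ k)) ∎
        where
        t = n ∸ suc k
        n∸k≡1+t : n ∸ k ≡ suc t
        n∸k≡1+t = ℕ.+-∸-assoc 1 k<n

    qbinom-pascal₁ : ∀ {n k} → k ≤ n → QFactorialsNonzero (suc n) →
                     qbinom q (suc n) (suc k) ≈ qbinom q n k + pow q (suc k) * qbinom q n (suc k)
    qbinom-pascal₁ {n} {k} k≤n nz = sym (qbinom-unique (s≤s k≤n) nz (begin
      (qbinom q n k + pow q (suc k) * qbinom q n (suc k)) * W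
        ≈⟨ trans (distribʳ _ _ _) (+-congˡ (*-assoc _ _ _)) ⟩
      qbinom q n k * W + pow q (suc k) * (qbinom q n (suc k) * W)
        ≈⟨ +-cong (qbinom-*-poch-suc k≤n nzₙ) (*-congˡ (qbinom-suc-*-poch-suc k≤n nzₙ)) ⟩
      poch q q n * (1# - pow q (suc k)) + pow q (suc k) * (poch q q n * (1# - pow q (n ∸ k)))
        ≈⟨ solve 3 (λ p a b → p :* (con (+ 1) :- a) :+ a :* (p :* (con (+ 1) :- b)) := p :* (con (+ 1) :- a :* b)) refl _ _ _ ⟩
      poch q q n * (1# - pow q (suc k) * pow q (n ∸ k))
        ≈⟨ *-congˡ (+-congˡ (-‿cong (trans (pow-+-∸ q 1 k≤n) (*-comm _ q)))) ⟩
      poch q q (suc n) ∎))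
      where
      W = poch q q (suc k) * poch q q (n ∸ k)
      nzₙ = QFactorialsNonzero-pred nz

    qbinom-pascal₂ : ∀ {n k} → k ≤ n → QFactorialsNonzero (suc n) →
                     qbinom q (suc n) (suc k) ≈ qbinom q n (suc k) + pow q (n ∸ k) * qbinom q n k
    qbinom-pascal₂ {n} {k} k≤n nz = sym (qbinom-unique (s≤s k≤n) nz (begin
      (qbinom q n (suc k) + pow q (n ∸ k) * qbinom q n k) * W
        ≈⟨ trans (distribʳ _ _ _) (+-congˡ (*-assoc _ _ _)) ⟩
      qbinom q n (suc k) * W + pow q (n ∸ k) * (qbinom q n k * W)
        ≈⟨ +-cong (qbinom-suc-*-poch-suc k≤n nzₙ) (*-congˡ (qbinom-*-poch-suc k≤n nzₙ)) ⟩
      poch q q n * (1# - pow q (n ∸ k)) + pow q (n ∸ k) * (poch q q n * (1# - pow q (suc k)))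
        ≈⟨ solve 3 (λ p a b → p :* (con (+ 1) :- b) :+ b :* (p :* (con (+ 1) :- a)) := p :* (con (+ 1) :- a :* b)) refl _ _ _ ⟩
      poch q q n * (1# - pow q (suc k) * pow q (n ∸ k))
        ≈⟨ *-congˡ (+-congˡ (-‿cong (trans (pow-+-∸ q 1 k≤n) (*-comm _ q)))) ⟩
      poch q q (suc n) ∎))
      where
      W = poch q q (suc k) * poch q q (n ∸ k)
      nzₙ = QFactorialsNonzero-pred nz

    qbinom-absorption : ∀ {n k} → k ≤ n → QFactorialsNonzero (suc n) →
      qbinom q (suc n) (suc k) * poch q q (suc k) ≈ (1# - q * pow q n) * qbinom q n k * poch q q k
    qbinom-absorption {n} {k} k≤n nz = *-cancelʳ (nz (n ∸ k) (ℕ.≤-trans (ℕ.m∸n≤m n k) (ℕ.n≤1+n n))) (begin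
      qbinom q (suc n) (suc k) * poch q q (suc k) * poch q q (n ∸ k)   ≈⟨ *-assoc _ _ _ ⟩
      qbinom q (suc n) (suc k) * (poch q q (suc k) * poch q q (n ∸ k)) ≈⟨ qbinom-*-poch (s≤s k≤n) nz ⟩
      poch q q n * (1# - q * pow q n)                                  ≈⟨ *-congʳ (qbinom-*-poch k≤n (QFactorialsNonzero-pred nz)) ⟨
      qbinom q n k * (poch q q k * poch q q (n ∸ k)) * (1# - q * pow q n)
        ≈⟨ solve 4 (λ g a b t → g :* (a :* b) :* t := t :* g :* a :* b) refl _ _ _ _ ⟩
      (1# - q * pow q n) * qbinom q n k * poch q q k * poch q q (n ∸ k) ∎)

    qbinom-*-qbinom : ∀ k n i → i ≤ n → QFactorialsNonzero (k ℕ.+ n) →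
      qbinom q (k ℕ.+ n) (k ℕ.+ i) * qbinom q (k ℕ.+ i) k ≈ qbinom q (k ℕ.+ n) k * qbinom q n i
    qbinom-*-qbinom k n i i≤n nz = *-cancelʳ W≉0 (begin
      [k+n,k+i] * [k+i,k] * (P k * P i * P (n ∸ i))
        ≈⟨ solve 5 (λ a b c d e → a :* b :* (c :* d :* e) := a :* (b :* (c :* d) :* e)) refl _ _ _ _ _ ⟩
      [k+n,k+i] * ([k+i,k] * (P k * P i) * P (n ∸ i))
        ≈⟨ *-congˡ (*-congʳ (qbinom-*-poch′ (ℕ.m≤m+n k i) (QFactorialsNonzero-≤ k+i≤k+n nz) (ℕ.m+n∸m≡n k i))) ⟩
      [k+n,k+i] * (P (k ℕ.+ i) * P (n ∸ i))               ≈⟨ qbinom-*-poch′ k+i≤k+n nz (ℕ.[m+n]∸[m+o]≡n∸o k n i) ⟩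
      P (k ℕ.+ n)                                         ≈⟨ qbinom-*-poch′ (ℕ.m≤m+n k n) nz (ℕ.m+n∸m≡n k n) ⟨
      [k+n,k] * (P k * P n)                               ≈⟨ *-congˡ (*-congˡ (qbinom-*-poch i≤n nzₙ)) ⟨
      [k+n,k] * (P k * ([n,i] * (P i * P (n ∸ i))))
        ≈⟨ solve 5 (λ a b c d e → a :* (c :* (b :* (d :* e))) := a :* b :* (c :* d :* e)) refl _ _ _ _ _ ⟩
      [k+n,k] * [n,i] * (P k * P i * P (n ∸ i))           ∎)
      where
      P = poch q q
      [k+n,k+i] = qbinom q (k ℕ.+ n) (k ℕ.+ i)
      [k+i,k] = qbinom q (k ℕ.+ i) k
      [k+n,k] = qbinom q (k ℕ.+ n) k
      [n,i] = qbinom q n i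
      nzₙ = QFactorialsNonzero-≤ (ℕ.m≤n+m n k) nz
      k+i≤k+n = ℕ.+-monoʳ-≤ k i≤n
      W≉0 = *-≉0 (*-≉0 (nz k (ℕ.m≤m+n k n)) (nzₙ i i≤n)) (nzₙ (n ∸ i) (ℕ.m∸n≤m n i))
      qbinom-*-poch′ : ∀ {m j l} → j ≤ m → QFactorialsNonzero m → m ∸ j ≡ l →
                       qbinom q m j * (P j * P l) ≈ P m
      qbinom-*-poch′ j≤m nzₘ ≡.refl = qbinom-*-poch j≤m nzₘ

    private
      qbinom-suc-0 : ∀ {n} → QFactorialsNonzero (suc n) → qbinom q (suc n) 0 ≈ qbinom q n 0
      qbinom-suc-0 nz = trans (qbinom-n-0 nz) (sym (qbinom-n-0 (QFactorialsNonzero-pred nz)))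

    ∑-qbinom-pascal₁ : ∀ n (f : ℕ → Carrier) → QFactorialsNonzero (suc n) →
      ∑[ i ≤ suc n ] (qbinom q (suc n) i * f i)
        ≈ ∑[ i ≤ n ] (qbinom q n i * f (suc i)) + ∑[ i ≤ n ] (pow q i * qbinom q n i * f i)
    ∑-qbinom-pascal₁ n f nz = begin
      ∑[ i ≤ suc n ] (qbinom q (suc n) i * f i)         ≈⟨ ∑-suc n _ ⟩
      head + ∑[ i ≤ n ] (qbinom q (suc n) (suc i) * f (suc i))
        ≈⟨ +-congˡ (trans (∑-cong n (λ i i≤n → trans (*-congʳ (qbinom-pascal₁ i≤n nz)) (distribʳ _ _ _))) (∑-+ n _ _)) ⟩
      head + (A + ∑[ i ≤ n ] B (suc i))                  ≈⟨ x+yz≈y+xz _ _ _ ⟩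
      A + (head + ∑[ i ≤ n ] B (suc i))                  ≈⟨ +-congˡ (+-congʳ (*-congʳ (trans (qbinom-suc-0 nz) (sym (*-identityˡ _))))) ⟩
      A + (B 0 + ∑[ i ≤ n ] B (suc i))                   ≈⟨ +-congˡ (∑-suc n B) ⟨
      A + sum≤ (suc n) B
        ≈⟨ +-congˡ (∑-extend (suc n) B (ℕ.n≤1+n n) (λ i n<i → trans (*-congʳ (trans (*-congˡ (qbinom-> n<i)) (zeroʳ _))) (zeroˡ _))) ⟨
      A + sum≤ n B                                       ∎
      where
      head = qbinom q (suc n) 0 * f 0
      A = ∑[ i ≤ n ] (qbinom q n i * f (suc i))
      B : ℕ → Carrier
      B i = pow q i * qbinom q n i * f i

    ∑-qbinom-pascal₂ : ∀ n (f : ℕ → Carrier) → QFactorialsNonzero (suc n) →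
      ∑[ i ≤ suc n ] (qbinom q (suc n) i * f i)
        ≈ ∑[ i ≤ n ] (qbinom q n i * f i) + ∑[ i ≤ n ] (pow q (n ∸ i) * qbinom q n i * f (suc i))
    ∑-qbinom-pascal₂ n f nz = begin
      ∑[ i ≤ suc n ] (qbinom q (suc n) i * f i)         ≈⟨ ∑-suc n _ ⟩
      head + ∑[ i ≤ n ] (qbinom q (suc n) (suc i) * f (suc i))
        ≈⟨ +-congˡ (trans (∑-cong n (λ i i≤n → trans (*-congʳ (qbinom-pascal₂ i≤n nz)) (distribʳ _ _ _))) (∑-+ n _ _)) ⟩
      head + (∑[ i ≤ n ] A (suc i) + B)                  ≈⟨ +-assoc _ _ _ ⟨
      (head + ∑[ i ≤ n ] A (suc i)) + B                  ≈⟨ +-congʳ (+-congʳ (*-congʳ (qbinom-suc-0 nz))) ⟩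
      (A 0 + ∑[ i ≤ n ] A (suc i)) + B                   ≈⟨ +-congʳ (∑-suc n A) ⟨
      sum≤ (suc n) A + B
        ≈⟨ +-congʳ (∑-extend (suc n) A (ℕ.n≤1+n n) (λ i n<i → trans (*-congʳ (qbinom-> n<i)) (zeroˡ _))) ⟨
      sum≤ n A + B                                       ∎
      where
      head = qbinom q (suc n) 0 * f 0
      A : ℕ → Carrier
      A i = qbinom q n i * f i
      B = ∑[ i ≤ n ] (pow q (n ∸ i) * qbinom q n i * f (suc i))

    q-Vandermonde : ∀ n h u → QFactorialsNonzero n →
      ∑[ i ≤ n ] (qbinom q n i * (poch q h (n ∸ i) * hpoch h u i)) ≈ poch q u n
    q-Vandermonde zero h u nz = trans (*-cong (qbinom-n-0 nz) (*-identityˡ 1#)) (*-identityˡ 1#)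
    q-Vandermonde (suc n) h u nz = begin
      ∑[ i ≤ suc n ] (qbinom q (suc n) i * (poch q h (suc n ∸ i) * hpoch h u i))
        ≈⟨ ∑-qbinom-pascal₁ n _ nz ⟩
      ∑[ i ≤ n ] (qbinom q n i * (poch q h (n ∸ i) * hpoch h u (suc i)))
        + ∑[ i ≤ n ] (pow q i * qbinom q n i * (poch q h (suc n ∸ i) * hpoch h u i))
        ≈⟨ +-cong (trans (∑-cong n (λ i _ → shifted i)) (sym (∑-distribˡ n _ _)))
                  (trans (∑-cong n unshifted) (sym (∑-distribˡ n _ _))) ⟩
      (h - u) * ∑[ i ≤ n ] (qbinom q n i * (poch q h (n ∸ i) * hpoch h (u * q) i))
        + (1# - h) * ∑[ i ≤ n ] (qbinom q n i * (poch q (h * q) (n ∸ i) * hpoch (h * q) (u * q) i))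
        ≈⟨ +-cong (*-congˡ (q-Vandermonde n h (u * q) nzₙ)) (*-congˡ (q-Vandermonde n (h * q) (u * q) nzₙ)) ⟩
      (h - u) * poch q (u * q) n + (1# - h) * poch q (u * q) n
        ≈⟨ solve 3 (λ h u p → (h :- u) :* p :+ (con (+ 1) :- h) :* p := (con (+ 1) :- u) :* p) refl h u _ ⟩
      (1# - u) * poch q (u * q) n
        ≈⟨ poch-suc u n ⟨
      poch q u (suc n) ∎
      where
      nzₙ = QFactorialsNonzero-pred nz
      shifted : ∀ i → qbinom q n i * (poch q h (n ∸ i) * hpoch h u (suc i))
                      ≈ (h - u) * (qbinom q n i * (poch q h (n ∸ i) * hpoch h (u * q) i))
      shifted i = begin
        qbinom q n i * (poch q h (n ∸ i) * hpoch h u (suc i))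
          ≈⟨ *-congˡ (*-congˡ (hpoch-suc h u i)) ⟩
        qbinom q n i * (poch q h (n ∸ i) * ((h - u) * hpoch h (u * q) i))
          ≈⟨ solve 4 (λ g p a b → g :* (p :* (a :* b)) := a :* (g :* (p :* b))) refl _ _ _ _ ⟩
        (h - u) * (qbinom q n i * (poch q h (n ∸ i) * hpoch h (u * q) i)) ∎
      unshifted : ∀ i → i ≤ n → pow q i * qbinom q n i * (poch q h (suc n ∸ i) * hpoch h u i)
                                ≈ (1# - h) * (qbinom q n i * (poch q (h * q) (n ∸ i) * hpoch (h * q) (u * q) i))
      unshifted i i≤n = begin
        pow q i * qbinom q n i * (poch q h (suc n ∸ i) * hpoch h u i)
          ≡⟨ ≡.cong (λ m → pow q i * qbinom q n i * (poch q h m * hpoch h u i)) (ℕ.+-∸-assoc 1 i≤n) ⟩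
        pow q i * qbinom q n i * (poch q h (suc (n ∸ i)) * hpoch h u i)
          ≈⟨ *-congˡ (*-congʳ (poch-suc h (n ∸ i))) ⟩
        pow q i * qbinom q n i * ((1# - h) * poch q (h * q) (n ∸ i) * hpoch h u i)
          ≈⟨ solve 5 (λ a b c d e → a :* b :* (c :* d :* e) := c :* (b :* (d :* (a :* e)))) refl _ _ _ _ _ ⟩
        (1# - h) * (qbinom q n i * (poch q (h * q) (n ∸ i) * (pow q i * hpoch h u i)))
          ≈⟨ *-congˡ (*-congˡ (*-congˡ (trans (hpoch-scale q h u i) (hpoch-cong i (*-comm q h) (*-comm q u))))) ⟩
        (1# - h) * (qbinom q n i * (poch q (h * q) (n ∸ i) * hpoch (h * q) (u * q) i)) ∎

    module _ (d : Carrier) where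

      expansionTerm : ℕ → Carrier → Carrier → ℕ → Carrier
      expansionTerm j c z k =
        pow c (j ∸ k) * poch q (z * pow q (suc (suc k))) (j ∸ k) * pow (- z) k * pow q (tri k) * hpoch d (c * q) k

      private
        expansionTerm-suc : ∀ {j k} c z → k ≤ j →
          expansionTerm (suc j) c z k ≈ c * (1# - z * pow q (suc (suc j))) * expansionTerm j c z k
        expansionTerm-suc {j} {k} c z k≤j = begin
          expansionTerm (suc j) c z k
            ≡⟨ ≡.cong (λ m → pow c m * poch q x m * pow (- z) k * pow q (tri k) * hpoch d (c * q) k) (ℕ.+-∸-assoc 1 k≤j) ⟩
          pow c (j ∸ k) * c * (poch q x (j ∸ k) * (1# - x * pow q (j ∸ k))) * pow (- z) k * pow q (tri k) * hpoch d (c * q) k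
            ≈⟨ *-congʳ (*-congʳ (*-congʳ (*-congˡ (*-congˡ (+-congˡ (-‿cong (trans (*-assoc _ _ _) (*-congˡ (pow-+-∸ q 2 k≤j))))))))) ⟩
          pow c (j ∸ k) * c * (poch q x (j ∸ k) * (1# - z * pow q (suc (suc j)))) * pow (- z) k * pow q (tri k) * hpoch d (c * q) k
            ≈⟨ solve 8 (λ a c b e f g h t → a :* c :* (b :* e) :* f :* g :* h := c :* e :* (a :* b :* f :* g :* h)) refl _ c _ _ _ _ _ c ⟩
          c * (1# - z * pow q (suc (suc j))) * expansionTerm j c z k ∎
          where
          x = z * pow q (suc (suc k))

        expansionTerm-shift : ∀ j k c z →
          pow q (j ∸ k) * expansionTerm (suc j) c z (suc k) ≈ - (z * q) * (d - c * q) * expansionTerm j (c * q) (z * q) k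
        expansionTerm-shift j k c z = begin
          pow q (j ∸ k) * (pow c (j ∸ k) * poch q (z * pow q (3 ℕ.+ k)) (j ∸ k) * (pow (- z) k * - z)
                           * pow q (tri (suc k)) * hpoch d (c * q) (suc k))
            ≈⟨ *-congˡ (*-cong (*-cong (*-congʳ (*-congˡ (poch-cong (j ∸ k) (solve 3 (λ z a q → z :* (a :* q) := z :* q :* a) refl z _ q))))
                                       (pow-tri-suc q k))
                               (hpoch-suc d (c * q) k)) ⟩
          pow q (j ∸ k) * (pow c (j ∸ k) * P * (pow (- z) k * - z) * (pow q k * q * pow q (tri k)) * ((d - c * q) * hpoch d (c * q * q) k))
            ≈⟨ solve 11 (λ qʲ cʲ P zᵏ z qᵏ q t d c h → qʲ :* (cʲ :* P :* (zᵏ :* :- z) :* (qᵏ :* q :* t) :* ((d :- c :* q) :* h))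
                     := :- (z :* q) :* (d :- c :* q) :* (qʲ :* cʲ :* P :* (zᵏ :* qᵏ) :* t :* h)) refl _ _ _ _ z _ q _ d c _ ⟩
          - (z * q) * (d - c * q) * (pow q (j ∸ k) * pow c (j ∸ k) * P * (pow (- z) k * pow q k) * pow q (tri k) * hpoch d (c * q * q) k)
            ≈⟨ *-congˡ (*-congʳ (*-congʳ (*-cong (*-congʳ (trans (*-comm _ _) (sym (pow-* c q (j ∸ k)))))
                                                  (trans (sym (pow-* (- z) q k)) (pow-cong k (sym (-‿distribˡ-* z q))))))) ⟩
          - (z * q) * (d - c * q) * expansionTerm j (c * q) (z * q) k ∎
          where
          P = poch q (z * q * pow q (suc (suc k))) (j ∸ k)

      hpoch-expansion : ∀ j c z → QFactorialsNonzero j →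
        hpoch c (z * d * q) j ≈ ∑[ k ≤ j ] (qbinom q j k * expansionTerm j c z k)
      hpoch-expansion zero c z nz = sym (trans (*-congʳ (qbinom-n-0 nz))
        (solve 0 (con (+ 1) :* (con (+ 1) :* con (+ 1) :* con (+ 1) :* con (+ 1) :* con (+ 1)) := con (+ 1)) refl))
      hpoch-expansion (suc j) c z nz = sym (begin
        ∑[ k ≤ suc j ] (qbinom q (suc j) k * expansionTerm (suc j) c z k)
          ≈⟨ ∑-qbinom-pascal₂ j _ nz ⟩
        ∑[ k ≤ j ] (qbinom q j k * expansionTerm (suc j) c z k)
          + ∑[ k ≤ j ] (pow q (j ∸ k) * qbinom q j k * expansionTerm (suc j) c z (suc k))
          ≈⟨ +-cong (trans (∑-cong j (λ k k≤j → trans (*-congˡ (expansionTerm-suc c z k≤j)) (x*yz≈y*xz _ _ _)))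
                           (sym (∑-distribˡ j _ _)))
                    (trans (∑-cong j (λ k _ → shifted k)) (sym (∑-distribˡ j _ _))) ⟩
        c * (1# - z * pow q (suc (suc j))) * ∑[ k ≤ j ] (qbinom q j k * expansionTerm j c z k)
          + - (z * q) * (d - c * q) * ∑[ k ≤ j ] (qbinom q j k * expansionTerm j (c * q) (z * q) k)
          ≈⟨ +-cong (*-congˡ (sym (hpoch-expansion j c z nzⱼ))) (*-congˡ (sym (hpoch-expansion j (c * q) (z * q) nzⱼ))) ⟩
        c * (1# - z * pow q (suc (suc j))) * W + - (z * q) * (d - c * q) * hpoch (c * q) (z * q * d * q) j
          ≈⟨ +-congˡ (*-congˡ (sym (trans (hpoch-scale q c (z * d * q) j)
               (hpoch-cong j (*-comm q c) (solve 3 (λ q z d → q :* (z :* d :* q) := z :* q :* d :* q) refl q z d))))) ⟩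
        c * (1# - z * pow q (suc (suc j))) * W + - (z * q) * (d - c * q) * (pow q j * W)
          ≈⟨ solve 6 (λ c z q qʲ W d → c :* (con (+ 1) :- z :* (qʲ :* q :* q)) :* W :+ :- (z :* q) :* (d :- c :* q) :* (qʲ :* W)
                := W :* (c :- z :* d :* q :* qʲ)) refl c z q _ _ d ⟩
        hpoch c (z * d * q) (suc j) ∎)
        where
        nzⱼ = QFactorialsNonzero-pred nz
        W = hpoch c (z * d * q) j
        shifted : ∀ k → pow q (j ∸ k) * qbinom q j k * expansionTerm (suc j) c z (suc k)
                        ≈ - (z * q) * (d - c * q) * (qbinom q j k * expansionTerm j (c * q) (z * q) k)
        shifted k = trans (trans (*-congʳ (*-comm _ _)) (*-assoc _ _ _))
                          (trans (*-congˡ (expansionTerm-shift j k c z)) (x*yz≈y*xz _ _ _))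

    module _ (c d e z : Carrier) where

      hpoch-expansion-padded : ∀ {j M} → j ≤ M → QFactorialsNonzero j →
        hpoch c (z * d * q) j * poch q (z * pow q (suc (suc j))) (M ∸ j)
          ≈ ∑[ k ≤ M ] (qbinom q j k * (pow c (j ∸ k)
                 * (poch q (z * pow q (suc (suc k))) (M ∸ k) * pow (- z) k * pow q (tri k) * hpoch d (c * q) k)))
      hpoch-expansion-padded {j} {M} j≤M nz = begin
        hpoch c (z * d * q) j * tail                                ≈⟨ *-congʳ (hpoch-expansion d j c z nz) ⟩
        ∑[ k ≤ j ] (qbinom q j k * expansionTerm d j c z k) * tail  ≈⟨ ∑-distribʳ j tail _ ⟩
        ∑[ k ≤ j ] (qbinom q j k * expansionTerm d j c z k * tail)
          ≈⟨ ∑-cong j (λ k k≤j → trans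
               (solve 7 (λ g a b u v w t → g :* (a :* b :* u :* v :* w) :* t := g :* (a :* (b :* t :* u :* v :* w))) refl _ _ _ _ _ _ _)
               (*-congˡ (*-congˡ (*-congʳ (*-congʳ (*-congʳ (merge k≤j))))))) ⟩
        ∑[ k ≤ j ] (qbinom q j k * (pow c (j ∸ k) * B k))
          ≈⟨ ∑-extend M _ j≤M (λ k j<k → trans (*-congʳ (qbinom-> j<k)) (zeroˡ _)) ⟩
        ∑[ k ≤ M ] (qbinom q j k * (pow c (j ∸ k) * B k))           ∎
        where
        tail = poch q (z * pow q (suc (suc j))) (M ∸ j)
        B : ℕ → Carrier
        B k = poch q (z * pow q (suc (suc k))) (M ∸ k) * pow (- z) k * pow q (tri k) * hpoch d (c * q) k
        merge : ∀ {k} → k ≤ j → poch q (z * pow q (suc (suc k))) (j ∸ k) * tail ≈ poch q (z * pow q (suc (suc k))) (M ∸ k)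
        merge {k} k≤j = begin
          poch q x (j ∸ k) * tail
            ≈⟨ *-congˡ (poch-cong (M ∸ j) (trans (*-congˡ (sym (pow-+-∸ q 2 k≤j))) (sym (*-assoc _ _ _)))) ⟩
          poch q x (j ∸ k) * poch q (x * pow q (j ∸ k)) (M ∸ j)   ≈⟨ poch-+ x (j ∸ k) (M ∸ j) ⟨
          poch q x ((j ∸ k) ℕ.+ (M ∸ j))                          ≡⟨ ≡.cong (poch q x) (∸-telescope k≤j j≤M) ⟩
          poch q x (M ∸ k)                                        ∎
          where
          x = z * pow q (suc (suc k))

      ∑-qbinom-*-qbinom : ∀ {k M} n → k ℕ.+ n ≡ M → QFactorialsNonzero M →
        ∑[ j ≤ M ] (qbinom q M j * qbinom q j k * (poch q (c * e * q) (M ∸ j) * pow q j * hpoch e q j * pow c (j ∸ k)))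
          ≈ qbinom q M k * (pow q k * hpoch e q k * poch q (c * pow q (suc (suc k))) n)
      ∑-qbinom-*-qbinom {k} n ≡.refl nz = begin
        sum≤ (k ℕ.+ n) g
          ≈⟨ ∑-dropInitial k n g (λ j j<k → trans (*-congʳ (trans (*-congˡ (qbinom-> j<k)) (zeroʳ _))) (zeroˡ _)) ⟩
        ∑[ i ≤ n ] g (k ℕ.+ i)
          ≈⟨ ∑-cong n step ⟩
        ∑[ i ≤ n ] (A * (qbinom q n i * (poch q (c * e * q) (n ∸ i) * hpoch (c * e * q) (c * pow q (suc (suc k))) i)))
          ≈⟨ ∑-distribˡ n A _ ⟨
        A * ∑[ i ≤ n ] (qbinom q n i * (poch q (c * e * q) (n ∸ i) * hpoch (c * e * q) (c * pow q (suc (suc k))) i))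
          ≈⟨ *-congˡ (q-Vandermonde n (c * e * q) (c * pow q (suc (suc k))) (QFactorialsNonzero-≤ (ℕ.m≤n+m n k) nz)) ⟩
        A * poch q (c * pow q (suc (suc k))) n
          ≈⟨ *-assoc _ _ _ ⟩
        qbinom q (k ℕ.+ n) k * (pow q k * hpoch e q k * poch q (c * pow q (suc (suc k))) n) ∎
        where
        g : ℕ → Carrier
        g j = qbinom q (k ℕ.+ n) j * qbinom q j k * (poch q (c * e * q) (k ℕ.+ n ∸ j) * pow q j * hpoch e q j * pow c (j ∸ k))
        A = qbinom q (k ℕ.+ n) k * (pow q k * hpoch e q k)
        step : ∀ i → i ≤ n → g (k ℕ.+ i) ≈ A * (qbinom q n i * (poch q (c * e * q) (n ∸ i) * hpoch (c * e * q) (c * pow q (suc (suc k))) i))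
        step i i≤n = begin
          g (k ℕ.+ i)
            ≡⟨ ≡.cong₂ (λ u v → qbinom q (k ℕ.+ n) (k ℕ.+ i) * qbinom q (k ℕ.+ i) k
                                  * (poch q (c * e * q) u * pow q (k ℕ.+ i) * hpoch e q (k ℕ.+ i) * pow c v))
                       (ℕ.[m+n]∸[m+o]≡n∸o k n i) (ℕ.m+n∸m≡n k i) ⟩
          qbinom q (k ℕ.+ n) (k ℕ.+ i) * qbinom q (k ℕ.+ i) k * (poch q (c * e * q) (n ∸ i) * pow q (k ℕ.+ i) * hpoch e q (k ℕ.+ i) * pow c i)
            ≈⟨ *-cong (qbinom-*-qbinom k n i i≤n nz) (*-congʳ (*-cong (*-congˡ (pow-+ q k i)) (hpoch-+ e q k i))) ⟩
          qbinom q (k ℕ.+ n) k * qbinom q n i * (poch q (c * e * q) (n ∸ i) * (pow q k * pow q i) * (hpoch e q k * hpoch e (q * pow q k) i) * pow c i)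
            ≈⟨ solve 8 (λ a b p qᵏ qⁱ eᵏ h cⁱ → a :* b :* (p :* (qᵏ :* qⁱ) :* (eᵏ :* h) :* cⁱ)
                                                := a :* (qᵏ :* eᵏ) :* (b :* (p :* (cⁱ :* qⁱ :* h))))
                 refl _ _ _ _ _ _ _ _ ⟩
          A * (qbinom q n i * (poch q (c * e * q) (n ∸ i) * (pow c i * pow q i * hpoch e (q * pow q k) i)))
            ≈⟨ *-congˡ (*-congˡ (*-congˡ (trans (*-congʳ (sym (pow-* c q i))) (trans (hpoch-scale (c * q) e (q * pow q k) i)
                 (hpoch-cong i (solve 3 (λ c q e → c :* q :* e := c :* e :* q) refl c q e)
                               (solve 3 (λ c q qᵏ → c :* q :* (q :* qᵏ) := c :* (qᵏ :* q :* q)) refl c q _)))))) ⟩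
          A * (qbinom q n i * (poch q (c * e * q) (n ∸ i) * hpoch (c * e * q) (c * pow q (suc (suc k))) i)) ∎

      clearedLhsTerm : ℕ → ℕ → Carrier
      clearedLhsTerm M k = pow (- z) k * pow q (tri k) * pow q k * hpoch d (c * q) k * hpoch e q k
                           * poch q (z * pow q (suc (suc k))) (M ∸ k) * poch q (c * pow q (suc (suc k))) (M ∸ k)

      clearedRhsTerm : ℕ → ℕ → Carrier
      clearedRhsTerm M j = poch q (c * e * q) (M ∸ j) * pow q j * hpoch c (z * d * q) j * hpoch e q j
                           * poch q (z * pow q (suc (suc j))) (M ∸ j)

      cleared-identity : ∀ M → QFactorialsNonzero M →
        ∑[ k ≤ M ] (qbinom q M k * clearedLhsTerm M k) ≈ ∑[ j ≤ M ] (qbinom q M j * clearedRhsTerm M j)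
      cleared-identity M nz = sym (begin
        ∑[ j ≤ M ] (qbinom q M j * clearedRhsTerm M j)
          ≈⟨ ∑-cong M (λ j j≤M → trans
               (solve 6 (λ g p qʲ w eʲ t → g :* (p :* qʲ :* w :* eʲ :* t) := g :* (p :* qʲ :* eʲ) :* (w :* t)) refl _ _ _ _ _ _)
               (*-congˡ (hpoch-expansion-padded j≤M (QFactorialsNonzero-≤ j≤M nz)))) ⟩
        ∑[ j ≤ M ] (A j * ∑[ k ≤ M ] (qbinom q j k * (pow c (j ∸ k) * B k)))
          ≈⟨ ∑-cong M (λ j _ → ∑-distribˡ M (A j) _) ⟩
        ∑[ j ≤ M ] ∑[ k ≤ M ] (A j * (qbinom q j k * (pow c (j ∸ k) * B k)))
          ≈⟨ ∑-comm M M _ ⟩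
        ∑[ k ≤ M ] ∑[ j ≤ M ] (A j * (qbinom q j k * (pow c (j ∸ k) * B k)))
          ≈⟨ ∑-cong M (λ k _ → ∑-cong M (λ j _ →
               solve 7 (λ g p qʲ eʲ h cʲ b → g :* (p :* qʲ :* eʲ) :* (h :* (cʲ :* b)) := b :* (g :* h :* (p :* qʲ :* eʲ :* cʲ)))
                 refl _ _ _ _ _ _ _)) ⟩
        ∑[ k ≤ M ] ∑[ j ≤ M ] (B k * (qbinom q M j * qbinom q j k * (poch q (c * e * q) (M ∸ j) * pow q j * hpoch e q j * pow c (j ∸ k))))
          ≈⟨ ∑-cong M (λ k _ → ∑-distribˡ M (B k) _) ⟨
        ∑[ k ≤ M ] (B k * ∑[ j ≤ M ] (qbinom q M j * qbinom q j k * (poch q (c * e * q) (M ∸ j) * pow q j * hpoch e q j * pow c (j ∸ k))))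
          ≈⟨ ∑-cong M (λ k k≤M → *-congˡ (∑-qbinom-*-qbinom (M ∸ k) (ℕ.m+[n∸m]≡n k≤M) nz)) ⟩
        ∑[ k ≤ M ] (B k * (qbinom q M k * (pow q k * hpoch e q k * poch q (c * pow q (suc (suc k))) (M ∸ k))))
          ≈⟨ ∑-cong M (λ k _ →
               solve 8 (λ t zᵏ τ h g qᵏ eᵏ p → t :* zᵏ :* τ :* h :* (g :* (qᵏ :* eᵏ :* p))
                                               := g :* (zᵏ :* τ :* qᵏ :* h :* eᵏ :* t :* p))
                 refl _ _ _ _ _ _ _ _) ⟩
        ∑[ k ≤ M ] (qbinom q M k * clearedLhsTerm M k) ∎)
        where
        A : ℕ → Carrier
        A j = qbinom q M j * (poch q (c * e * q) (M ∸ j) * pow q j * hpoch e q j)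
        B : ℕ → Carrier
        B k = poch q (z * pow q (suc (suc k))) (M ∸ k) * pow (- z) k * pow q (tri k) * hpoch d (c * q) k

      lhsTerm : ℕ → ℕ → Carrier
      lhsTerm N n = qbinom q N n
        * ((poch q q n * poch q (c ÷ d) n * poch q (q ÷ e) (n ∸ 1) * pow (- (z * d)) n * pow q (tri n) * pow e (n ∸ 1))
           ÷ (poch q (z * q) n * poch q (c * q) n * poch q q (n ∸ 1)))

      rhsTerm : ℕ → ℕ → Carrier
      rhsTerm N n = qbinom q N n
        * ((poch q q n * poch q (c * e * q) (N ∸ n) * poch q ((z * d * q) ÷ c) (n ∸ 1) * poch q (q ÷ e) (n ∸ 1)
            * pow (c * q) n * pow e (n ∸ 1))
           ÷ (poch q (z * q) n * poch q q (n ∸ 1)))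

      private
        pow-*-poch-÷-head : ∀ m → ¬ d ≈ 0# →
          pow (- (z * d)) (suc m) * poch q (c ÷ d) (suc m) ≈ z * (c - d) * (pow (- z) m * hpoch d (c * q) m)
        pow-*-poch-÷-head m d≉0 = begin
          pow (- (z * d)) (suc m) * poch q (c ÷ d) (suc m)
            ≈⟨ *-congʳ (trans (pow-cong (suc m) (-‿distribˡ-* z d)) (pow-* (- z) d (suc m))) ⟩
          pow (- z) (suc m) * pow d (suc m) * poch q (c ÷ d) (suc m)
            ≈⟨ trans (*-assoc _ _ _) (*-congˡ (trans (pow-*-poch-÷ d c (suc m) d≉0) (hpoch-suc d c m))) ⟩
          pow (- z) m * - z * ((d - c) * hpoch d (c * q) m)
            ≈⟨ solve 5 (λ zᵐ z d c h → zᵐ :* :- z :* ((d :- c) :* h) := z :* (c :- d) :* (zᵐ :* h)) refl _ z d c _ ⟩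
          z * (c - d) * (pow (- z) m * hpoch d (c * q) m) ∎

        poch-suc-split : ∀ x {m M} → m ≤ M →
          poch q (x * q) (suc M) ≈ poch q (x * q) (suc m) * poch q (x * pow q (suc (suc m))) (M ∸ m)
        poch-suc-split x {m} {M} m≤M = trans (poch-split (x * q) (s≤s m≤M))
          (*-congˡ (poch-cong (M ∸ m) (solve 3 (λ x q qᵐ → x :* q :* (qᵐ :* q) := x :* (qᵐ :* q :* q)) refl x q _)))

        pow-*-poch-÷-tail : ∀ m → ¬ c ≈ 0# →
          pow (c * q) m * poch q ((z * d * q) ÷ c) m ≈ pow q m * hpoch c (z * d * q) m
        pow-*-poch-÷-tail m c≉0 = begin
          pow (c * q) m * poch q ((z * d * q) ÷ c) m         ≈⟨ *-congʳ (pow-* c q m) ⟩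
          pow c m * pow q m * poch q ((z * d * q) ÷ c) m     ≈⟨ *-congʳ (*-comm _ _) ⟩
          pow q m * pow c m * poch q ((z * d * q) ÷ c) m     ≈⟨ *-assoc _ _ _ ⟩
          pow q m * (pow c m * poch q ((z * d * q) ÷ c) m)   ≈⟨ *-congˡ (pow-*-poch-÷ c (z * d * q) m c≉0) ⟩
          pow q m * hpoch c (z * d * q) m                    ∎

      module _ {M : ℕ} (qfn : QFactorialsNonzero (suc M))
               (zq≉0 : ∀ n → n ≤ suc M → ¬ poch q (z * q) n ≈ 0#)
               (cq≉0 : ∀ n → n ≤ suc M → ¬ poch q (c * q) n ≈ 0#) where

        lhsTerm-suc : ∀ {m} → m ≤ M → ¬ d ≈ 0# → ¬ e ≈ 0# →
          lhsTerm (suc M) (suc m)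
            ≈ (z * (c - d) * (1# - q * pow q M) * q * (qbinom q M m * clearedLhsTerm M m))
              ÷ (poch q (z * q) (suc M) * poch q (c * q) (suc M))
        lhsTerm-suc {m} m≤M d≉0 e≉0 =
          trans (sym (*-assoc _ _ _)) (÷-cross den≉0 (*-≉0 (zq≉0 (suc M) ℕ.≤-refl) (cq≉0 (suc M) ℕ.≤-refl)) (begin
          qbinom q (suc M) (suc m) * (poch q q (suc m) * poch q (c ÷ d) (suc m) * poch q (q ÷ e) m * pow (- (z * d)) (suc m)
                                     * pow q (tri (suc m)) * pow e m) * (poch q (z * q) (suc M) * poch q (c * q) (suc M))
            ≈⟨ solve 9 (λ g p a b w t u Z C → g :* (p :* a :* b :* w :* t :* u) :* (Z :* C) := g :* p :* (w :* a) :* (u :* b) :* t :* Z :* C)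
                 refl _ _ _ _ _ _ _ _ _ ⟩
          qbinom q (suc M) (suc m) * poch q q (suc m) * (pow (- (z * d)) (suc m) * poch q (c ÷ d) (suc m)) * (pow e m * poch q (q ÷ e) m)
            * pow q (tri (suc m)) * poch q (z * q) (suc M) * poch q (c * q) (suc M)
            ≈⟨ *-cong (*-cong (*-cong (*-cong (*-cong (qbinom-absorption m≤M qfn) (pow-*-poch-÷-head m d≉0)) (pow-*-poch-÷ e q m e≉0))
                                      (pow-tri-suc q m)) (poch-suc-split z m≤M)) (poch-suc-split c m≤M) ⟩
          (1# - q * pow q M) * qbinom q M m * poch q q m * (z * (c - d) * (pow (- z) m * hpoch d (c * q) m)) * hpoch e q m
            * (pow q m * q * pow q (tri m))
            * (poch q (z * q) (suc m) * poch q (z * pow q (suc (suc m))) (M ∸ m))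
            * (poch q (c * q) (suc m) * poch q (c * pow q (suc (suc m))) (M ∸ m))
            ≈⟨ solve 14 (λ Q g p w zᵐ D E qᵐ q τ Z T C U →
                 Q :* g :* p :* (w :* (zᵐ :* D)) :* E :* (qᵐ :* q :* τ) :* (Z :* T) :* (C :* U)
                   := w :* Q :* q :* (g :* (zᵐ :* τ :* qᵐ :* D :* E :* T :* U)) :* (Z :* C :* p))
                 refl _ _ _ _ _ _ _ _ q _ _ _ _ _ ⟩
          z * (c - d) * (1# - q * pow q M) * q * (qbinom q M m * clearedLhsTerm M m)
            * (poch q (z * q) (suc m) * poch q (c * q) (suc m) * poch q q m) ∎))
          where
          den≉0 = *-≉0 (*-≉0 (zq≉0 (suc m) (s≤s m≤M)) (cq≉0 (suc m) (s≤s m≤M))) (qfn m (ℕ.m≤n⇒m≤1+n m≤M))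

        rhsTerm-suc : ∀ {m} → m ≤ M → ¬ c ≈ 0# → ¬ e ≈ 0# →
          rhsTerm (suc M) (suc m)
            ≈ ((1# - q * pow q M) * q * c * (qbinom q M m * clearedRhsTerm M m)) ÷ poch q (z * q) (suc M)
        rhsTerm-suc {m} m≤M c≉0 e≉0 = trans (sym (*-assoc _ _ _)) (÷-cross den≉0 (zq≉0 (suc M) ℕ.≤-refl) (begin
          qbinom q (suc M) (suc m) * (poch q q (suc m) * poch q (c * e * q) (M ∸ m) * poch q ((z * d * q) ÷ c) m * poch q (q ÷ e) m
                                     * (pow (c * q) m * (c * q)) * pow e m) * poch q (z * q) (suc M)
            ≈⟨ solve 10 (λ g p a b w r c q u Z → g :* (p :* a :* b :* w :* (r :* (c :* q)) :* u) :* Z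
                                                 := g :* p :* a :* (r :* b) :* (u :* w) :* (c :* q) :* Z)
                 refl _ _ _ _ _ _ c q _ _ ⟩
          qbinom q (suc M) (suc m) * poch q q (suc m) * poch q (c * e * q) (M ∸ m) * (pow (c * q) m * poch q ((z * d * q) ÷ c) m)
            * (pow e m * poch q (q ÷ e) m) * (c * q) * poch q (z * q) (suc M)
            ≈⟨ *-cong (*-congʳ (*-cong (*-cong (*-congʳ (qbinom-absorption m≤M qfn)) (pow-*-poch-÷-tail m c≉0)) (pow-*-poch-÷ e q m e≉0)))
                      (poch-suc-split z m≤M) ⟩
          (1# - q * pow q M) * qbinom q M m * poch q q m * poch q (c * e * q) (M ∸ m) * (pow q m * hpoch c (z * d * q) m)
            * hpoch e q m * (c * q) * (poch q (z * q) (suc m) * poch q (z * pow q (suc (suc m))) (M ∸ m))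
            ≈⟨ solve 11 (λ Q g p a qᵐ W E c q Z T →
                 Q :* g :* p :* a :* (qᵐ :* W) :* E :* (c :* q) :* (Z :* T)
                   := Q :* q :* c :* (g :* (a :* qᵐ :* W :* E :* T)) :* (Z :* p))
                 refl _ _ _ _ _ _ _ c q _ _ ⟩
          (1# - q * pow q M) * q * c * (qbinom q M m * clearedRhsTerm M m) * (poch q (z * q) (suc m) * poch q q m) ∎))
          where
          den≉0 = *-≉0 (zq≉0 (suc m) (s≤s m≤M)) (qfn m (ℕ.m≤n⇒m≤1+n m≤M))

corollary2p6 : ∀ {a ℓ} (F : Field a ℓ) →
    let open Field F
        open FieldOps F
    in
    (N : ℕ) (q c d e z : Carrier) →
    ¬ c ≈ 0# → ¬ d ≈ 0# → ¬ e ≈ 0# →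
    (∀ n → n ≤ N →
      (¬ poch q q n ≈ 0#) × (¬ poch q (z * q) n ≈ 0#) × (¬ poch q (c * q) n ≈ 0#)) →
    sum1 N (λ n →
      qbinom q N n
      * ((poch q q n * poch q (c ÷ d) n * poch q (q ÷ e) (n ∸ 1)
          * pow (- (z * d)) n * pow q (tri n) * pow e (n ∸ 1))
         ÷ (poch q (z * q) n * poch q (c * q) n * poch q q (n ∸ 1))))
    ≈ ((z * (c - d)) ÷ (c * poch q (c * q) N))
      * sum1 N (λ n →
          qbinom q N n
          * ((poch q q n * poch q (c * e * q) (N ∸ n) * poch q ((z * d * q) ÷ c) (n ∸ 1)
              * poch q (q ÷ e) (n ∸ 1) * pow (c * q) n * pow e (n ∸ 1))
             ÷ (poch q (z * q) n * poch q q (n ∸ 1))))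
corollary2p6 F zero q c d e z _ _ _ _ = sym (zeroʳ _)
  where open Field F
corollary2p6 F (suc M) q c d e z c≉0 d≉0 e≉0 nondegenerate = begin
  sum1 (suc M) (lhsTerm q c d e z (suc M))
    ≈⟨ sum1-suc-÷ M _ _ _ _ (λ m m≤M → lhsTerm-suc q c d e z qfn zq≉0 cq≉0 m≤M d≉0 e≉0) ⟩
  (z * (c - d) * Q * q * ∑[ m ≤ M ] (qbinom q M m * clearedLhsTerm q c d e z M m)) ÷ (Z * C)
    ≈⟨ *-congʳ (*-congˡ (cleared-identity q c d e z M (QFactorialsNonzero-pred q qfn))) ⟩
  (z * (c - d) * Q * q * ∑[ m ≤ M ] (qbinom q M m * clearedRhsTerm q c d e z M m)) ÷ (Z * C)
    ≈⟨ ÷-rescale (zq≉0 (suc M) ℕ.≤-refl) (cq≉0 (suc M) ℕ.≤-refl) c≉0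
         (solve 4 (λ w Q q c → w :* Q :* q :* c := w :* (Q :* q :* c)) refl (z * (c - d)) Q q c) ⟩
  ((z * (c - d)) ÷ (c * C)) * ((Q * q * c * ∑[ m ≤ M ] (qbinom q M m * clearedRhsTerm q c d e z M m)) ÷ Z)
    ≈⟨ *-congˡ (sum1-suc-÷ M _ _ _ _ (λ m m≤M → rhsTerm-suc q c d e z qfn zq≉0 cq≉0 m≤M c≉0 e≉0)) ⟨
  ((z * (c - d)) ÷ (c * C)) * sum1 (suc M) (rhsTerm q c d e z (suc M)) ∎
  where
  open Field F
  open FieldOps F
  open QSeries F
  open IntegerCoefficientSolver commutativeRing using (solve; _:=_; _:*_)
  open FiniteSums commutativeRing using (sum≤)
  open import Relation.Binary.Reasoning.Setoid setoid
  Q = 1# - q * pow q M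
  Z = poch q (z * q) (suc M)
  C = poch q (c * q) (suc M)
  qfn = λ n n≤N → proj₁ (nondegenerate n n≤N)
  zq≉0 = λ n n≤N → proj₁ (proj₂ (nondegenerate n n≤N))
  cq≉0 = λ n n≤N → proj₂ (proj₂ (nondegenerate n n≤N))
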